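{- For every odd positive integer $n$, the only parity-alternating permutation of $[n]$ avoiding both $132$ and $123$ is $[n,n-1,\dots,2,1]$. For every integer $m\ge1$, $\mathrm{p}_{132,123}(2m)=2^{m-1}$.
   Context: A parity-alternating permutation (PAP) of $[n]$ is a permutation $\pi$ with $\pi(i)\equiv i\pmod 2$ for all $i$. A permutation contains a pattern $\sigma$ if some subsequence of its one-line notation is order-isomorphic to $\sigma$, and avoids it otherwise. $\mathrm{p}_{\sigma,\tau}(n)$ is the number of PAPs of $[n]$ avoiding both $\sigma$ and $\tau$. -}

module Defs where

open import Data.Nat using (ℕ; zero; suc; _%_)
open import Data.Fin using (Fin; toℕ; _<_; opposite) renaming (zero to fz; suc to fs)
open import Data.Vec using (Vec; lookup; []; _∷_; tabulate)
open import Data.List using (List; length)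
open import Data.List.Membership.Propositional using (_∈_)
open import Data.List.Relation.Unary.Unique.Propositional using (Unique)
open import Data.Product using (Σ; _×_; ∃)
open import Function.Definitions using (Injective)
open import Relation.Binary.PropositionalEquality using (_≡_)
open import Relation.Nullary using (¬_)
open import Function.Bundles using (_⇔_)

-- A permutation of [n] in one-line notation: a length-n word over Fin n
-- (Fin n = {0,…,n-1} encodes [n] = {1,…,n} via i ↦ i+1) whose letters are distinct.
IsPerm : ∀ {n} → Vec (Fin n) n → Set
IsPerm π = Injective _≡_ _≡_ (lookup π)

-- Parity-alternating: π(i) ≡ i (mod 2). The shift by one of the encoding
-- does not affect the congruence.
IsPAP : ∀ {n} → Vec (Fin n) n → Set
IsPAP {n} π = IsPerm π × (∀ (i : Fin n) → toℕ (lookup π i) % 2 ≡ toℕ i % 2)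

Contains : ∀ {n k} → Vec (Fin n) n → Vec (Fin k) k → Set
Contains {n} {k} π σ =
  Σ (Fin k → Fin n) λ f →
    (∀ i j → i < j → f i < f j) ×
    (∀ i j → (lookup σ i < lookup σ j) ⇔ (lookup π (f i) < lookup π (f j)))

Avoids : ∀ {n k} → Vec (Fin n) n → Vec (Fin k) k → Set
Avoids π σ = ¬ Contains π σ

p132 : Vec (Fin 3) 3
p132 = fz ∷ fs (fs fz) ∷ fs fz ∷ []

p123 : Vec (Fin 3) 3
p123 = fz ∷ fs fz ∷ fs (fs fz) ∷ []

IsPAPAvoiding : ∀ {n k l} → Vec (Fin k) k → Vec (Fin l) l → Vec (Fin n) n → Set
IsPAPAvoiding σ τ π = IsPAP π × Avoids π σ × Avoids π τ

-- "p_{σ,τ}(n) = c": there is a duplicate-free list of exactly c words that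
-- lists precisely the PAPs of [n] avoiding σ and τ.
HasCount : ∀ {k l} → (n : ℕ) → Vec (Fin k) k → Vec (Fin l) l → ℕ → Set
HasCount n σ τ c =
  Σ (List (Vec (Fin n) n)) λ L →
    Unique L × length L ≡ c × (∀ π → (π ∈ L) ⇔ IsPAPAvoiding σ τ π)

decreasing : (n : ℕ) → Vec (Fin n) n
decreasing n = tabulate opposite

{-# OPTIONS --safe #-}
module Submission where

-- Read a permutation of {0, …, N-1} as a function f on ℕ; avoiding 123 and 132 means that no
-- entry is followed by two larger ones. If the maximum N-1 sits at position p, every earlier
-- entry already has it to its right, so every other later entry is smaller than that entry;
-- going from left to right this forces f to begin with the block N-2, N-3, …, N-1-p, N-1,
-- followed by a permutation of {0, …, N-2-p} of the same kind. Parity alternation makes every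
-- block have length 1 when N is odd, leaving only the decreasing permutation, and even length
-- when N is even. Conversely every concatenation of such blocks qualifies, so for N = 2(m+1)
-- the avoiders correspond to the compositions of m+1, of which there are 2^m.

open import Defs
open import Data.Nat using (ℕ; zero; suc; _+_; _*_; _^_; _∸_; _≤_; _<_; s≤s; z<s; s<s; _%_; _<?_; parity; NonZero)
open import Data.Nat.Properties
open import Data.Nat.DivMod using (_mod_; m<n⇒m%n≡m)
open import Data.Nat.Induction using (<-rec; <-wellFounded)
open import Data.Nat.ListAction using (sum)
open import Data.Nat.Tactic.RingSolver using (solve-∀)
open import Data.Parity.Base as ℙ using (Parity; 0ℙ; 1ℙ; _⁻¹)
import Data.Parity.Properties as ℙ
open import Data.Fin using (Fin; toℕ; fromℕ<; opposite; punchOut) renaming (zero to fzero; suc to fsuc)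
import Data.Fin as Fin
open import Data.Fin.Properties using (toℕ-injective; toℕ<n; toℕ-fromℕ<; fromℕ<-toℕ; any?; injective⇒≤; punchOut-injective; opposite-prop)
import Data.Fin.Properties as Fin
open import Data.Vec using (Vec; []; _∷_; lookup; tabulate)
open import Data.Vec.Properties using (lookup∘tabulate; tabulate∘lookup; tabulate-cong)
open import Data.List using (List; []; _∷_; map; _++_; length)
open import Data.List.Properties using (length-++; length-map; map-injective)
open import Data.List.Membership.Propositional using (_∈_)
open import Data.List.Membership.Propositional.Properties using (∈-map⁺; ∈-map⁻; ∈-++⁺ˡ; ∈-++⁺ʳ; ∈-++⁻)
open import Data.List.Relation.Unary.Any using (here; there)
import Data.List.Relation.Unary.All as All
import Data.List.Relation.Unary.All.Properties as All
import Data.List.Relation.Unary.AllPairs as AllPairs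
open import Data.List.Relation.Unary.Unique.Propositional using (Unique)
import Data.List.Relation.Unary.Unique.Propositional.Properties as Unique
open import Data.Product using (∃-syntax; ∃₂; _×_; _,_)
open import Data.Sum using (_⊎_; inj₁; inj₂)
open import Data.Empty using (⊥; ⊥-elim)
open import Function using (_∘_; _⇔_; mk⇔; Equivalence; Injective)
open import Induction.WellFounded using (Acc; acc)
open import Relation.Binary.Definitions using (tri<; tri≈; tri>)
open import Relation.Binary.PropositionalEquality
open import Relation.Nullary using (¬_; yes; no)

+-trade-< : ∀ {a b c d} → a + b ≡ c + d → b < d → c < a
+-trade-< eq b<d = ≰⇒> (λ a≤c → <-irrefl eq (+-mono-≤-< a≤c b<d))

+-trade-≤ : ∀ {a b c d} → a + b ≡ c + d → b ≤ d → c ≤ a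
+-trade-≤ eq b≤d = ≮⇒≥ (λ a<c → <-irrefl eq (+-mono-<-≤ a<c b≤d))

m+suc[n]≡o⇒m<o : ∀ {m n o} → m + suc n ≡ o → m < o
m+suc[n]≡o⇒m<o {m} eq = subst (m <_) eq (m<m+n m z<s)

m+n<o⇒∃[o′]o≡m+o′ : ∀ m {n o} → m + n < o → ∃[ o′ ] o ≡ m + o′ × n < o′
m+n<o⇒∃[o′]o≡m+o′ m {n} m+n<o with m≤n⇒∃[o]m+o≡n (≤-trans (m≤m+n m n) (<⇒≤ m+n<o))
... | o′ , refl = o′ , refl , +-cancelˡ-< m n o′ m+n<o

double-injective : ∀ {a b} → a + a ≡ b + b → a ≡ b
double-injective {a} {b} eq with <-cmp a b
... | tri< a<b _ _ = ⊥-elim (<-irrefl eq (+-mono-< a<b a<b))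
... | tri≈ _ a≡b _ = a≡b
... | tri> _ _ b<a = ⊥-elim (<-irrefl (sym eq) (+-mono-< b<a b<a))

parity-suc : ∀ n → parity (suc n) ≡ parity n ⁻¹
parity-suc = ℙ.+-homo-+ 1

parity-double : ∀ n → parity (n + n) ≡ 0ℙ
parity-double n = trans (ℙ.+-homo-+ n n) (ℙ.p+p≡0ℙ (parity n))

parity-cancelˡ : ∀ m n o → parity (m + n) ≡ parity (m + o) → parity n ≡ parity o
parity-cancelˡ m n o eq =
  ℙ.+-cancelˡ-≡ (parity m) _ _ (trans (sym (ℙ.+-homo-+ m n)) (trans eq (ℙ.+-homo-+ m o)))

parity-cancelʳ : ∀ m n o → parity (n + m) ≡ parity (o + m) → parity n ≡ parity o
parity-cancelʳ m n o eq =
  parity-cancelˡ m n o (trans (cong parity (+-comm m n)) (trans eq (cong parity (+-comm o m))))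

odd-m+suc[n]⇒same-parity : ∀ m n → parity (m + suc n) ≡ 1ℙ → parity m ≡ parity n
odd-m+suc[n]⇒same-parity m n odd = cases (parity m) (parity n)
  (trans (sym (trans (ℙ.+-homo-+ m (suc n)) (cong (parity m ℙ.+_) (parity-suc n)))) odd)
  where
  cases : ∀ x y → x ℙ.+ y ⁻¹ ≡ 1ℙ → x ≡ y
  cases 0ℙ 0ℙ _ = refl
  cases 1ℙ 1ℙ _ = refl
  cases 0ℙ 1ℙ ()
  cases 1ℙ 0ℙ ()

odd⇒≡suc[r+r] : ∀ n → parity n ≡ 1ℙ → ∃[ r ] n ≡ suc (r + r)
odd⇒≡suc[r+r] zero          ()
odd⇒≡suc[r+r] (suc zero)    _   = 0 , refl
odd⇒≡suc[r+r] (suc (suc n)) odd with odd⇒≡suc[r+r] n odd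
... | r , refl = suc r , cong (suc ∘ suc) (sym (+-suc r r))

suc[2*k]-odd : ∀ k → parity (suc (2 * k)) ≡ 1ℙ
suc[2*k]-odd k = trans (parity-suc (2 * k)) (cong _⁻¹ (ℙ.*-homo-* 2 k))

-- Permutations of {0, …, N-1} as functions on ℕ

InjectiveBelow : ℕ → (ℕ → ℕ) → Set
InjectiveBelow N f = ∀ {a b} → a < N → b < N → f a ≡ f b → a ≡ b

record Permutes (N : ℕ) (f : ℕ → ℕ) : Set where
  field
    bounded    : ∀ {a} → a < N → f a < N
    injective  : InjectiveBelow N f
    surjective : ∀ {w} → w < N → ∃[ a ] a < N × f a ≡ w

-- An entry followed by two larger ones is precisely an occurrence of 123 or 132.
NoTwoLargerLater : ℕ → (ℕ → ℕ) → Set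
NoTwoLargerLater N f = ∀ {a b c} → a < b → b < c → c < N → f a < f b → f a < f c → ⊥

-- f lists the entries at positions i, i + 1, … of a parity-alternating word.
record Alternates (i N : ℕ) (f : ℕ → ℕ) : Set where
  constructor alternates
  field parity-≡ : ∀ {j} → j < N → parity (f j) ≡ parity (i + j)
open Alternates public

noTwoLargerLater-unordered : ∀ {N f} → NoTwoLargerLater N f →
  ∀ {a b c} → a < b → a < c → b ≢ c → b < N → c < N → f a < f b → f a < f c → ⊥
noTwoLargerLater-unordered noTwo {b = b} {c} a<b a<c b≢c b<N c<N fa<fb fa<fc with <-cmp b c
... | tri< b<c _ _ = noTwo a<b b<c c<N fa<fb fa<fc
... | tri≈ _ b≡c _ = b≢c b≡c
... | tri> _ _ c<b = noTwo a<c c<b b<N fa<fc fa<fb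

noTwoLargerLater-shift : ∀ s {K f} → NoTwoLargerLater (s + K) f → NoTwoLargerLater K (f ∘ (s +_))
noTwoLargerLater-shift s noTwo a<b b<c c<K =
  noTwo (+-monoʳ-< s a<b) (+-monoʳ-< s b<c) (+-monoʳ-< s c<K)

alternates-shift : ∀ s {i K f} → Alternates i (s + K) f → Alternates (i + s) K (f ∘ (s +_))
alternates-shift s {i} alt = alternates λ {j} j<K →
  trans (parity-≡ alt (+-monoʳ-< s j<K)) (cong parity (sym (+-assoc i s j)))

IsReversal : ℕ → (ℕ → ℕ) → Set
IsReversal N f = ∀ {j} → j < N → f j + suc j ≡ N

module _ {N f} (rev : IsReversal N f) where

  reversal-injective : InjectiveBelow N f
  reversal-injective {a} {b} a<N b<N fa≡fb = suc-injective (+-cancelˡ-≡ (f a) _ _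
    (trans (rev a<N) (trans (sym (rev b<N)) (cong (_+ suc b) (sym fa≡fb)))))

  reversal-noTwoLargerLater : NoTwoLargerLater N f
  reversal-noTwoLargerLater {b = b} a<b b<c c<N fa<fb _ =
    <-asym fa<fb (+-trade-< (trans (rev (<-trans a<b b<N)) (sym (rev b<N))) (s<s a<b))
    where
    b<N : b < N
    b<N = <-trans b<c c<N

  reversal-alternates : parity N ≡ 1ℙ → Alternates 0 N f
  reversal-alternates N-odd = alternates λ {j} j<N →
    odd-m+suc[n]⇒same-parity (f j) j (trans (cong parity (rev j<N)) N-odd)

reversal-cons : ∀ {K f} → f 0 ≡ K → IsReversal K (f ∘ suc) → IsReversal (suc K) f
reversal-cons {f = f} f0≡K rev {zero}  _         = trans (+-comm (f 0) 1) (cong suc f0≡K)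
reversal-cons {f = f} f0≡K rev {suc j} (s<s j<K) = trans (+-suc (f (suc j)) (suc j)) (cong suc (rev j<K))

-- The first block

-- block p K t g  =  p + K - 1, p + K - 2, …, K, t, g 0, g 1, …
block : (p K t : ℕ) → (ℕ → ℕ) → ℕ → ℕ
block zero    K t g zero    = t
block zero    K t g (suc j) = g j
block (suc p) K t g zero    = p + K
block (suc p) K t g (suc j) = block p K t g j

record FirstBlock (p K : ℕ) (f g : ℕ → ℕ) : Set where
  field
    descent : ∀ {a} → a < p → f a + suc a ≡ p + K
    peak    : f p ≡ p + K
    rest    : ∀ j → f (suc p + j) ≡ g j

block-firstBlock : ∀ p {K g} → FirstBlock p K (block p K (p + K) g) g
block-firstBlock p = record { descent = descent p ; peak = peak p ; rest = rest p }
  where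
  descent : ∀ p {K t g a} → a < p → block p K t g a + suc a ≡ p + K
  descent (suc p) {K} {a = zero}  _         = +-comm (p + K) 1
  descent (suc p) {a = suc a}     (s<s a<p) = trans (+-suc _ (suc a)) (cong suc (descent p a<p))
  peak : ∀ p {K t g} → block p K t g p ≡ t
  peak zero    = refl
  peak (suc p) = peak p
  rest : ∀ p {K t g} j → block p K t g (suc p + j) ≡ g j
  rest zero    j = refl
  rest (suc p) j = rest p j

data Position (p : ℕ) : ℕ → Set where
  inDescent : ∀ {a} → a < p → Position p a
  atPeak    : Position p p
  inRest    : ∀ j → Position p (suc p + j)

position : ∀ p x → Position p x
position zero    zero    = atPeak
position zero    (suc j) = inRest j
position (suc p) zero    = inDescent z<s
position (suc p) (suc x) with position p x
... | inDescent a<p = inDescent (s<s a<p)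
... | atPeak        = atPeak
... | inRest j      = inRest j

module FirstBlockProperties {p K f g} (b : FirstBlock p K f g) where
  open FirstBlock b

  descent-≥ : ∀ {a} → a < p → K ≤ f a
  descent-≥ {a} a<p = +-trade-≤ (trans (descent a<p) (+-comm p K)) a<p

  descent-< : ∀ {a} → a < p → f a < p + K
  descent-< a<p = m+suc[n]≡o⇒m<o (descent a<p)

  peak-≥ : K ≤ f p
  peak-≥ = subst (K ≤_) (sym peak) (m≤n+m K p)

  module _ (g-bounded : ∀ {j} → j < K → g j < K) where

    rest-< : ∀ {j} → suc p + j < suc p + K → f (suc p + j) < K
    rest-< {j} x<N = subst (_< K) (sym (rest j)) (g-bounded (+-cancelˡ-< (suc p) j K x<N))

    rest-apart : ∀ {x j} → K ≤ f x → f x ≡ f (suc p + j) → suc p + j < suc p + K → ⊥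
    rest-apart K≤fx fx≡fy y<N = ≤⇒≯ K≤fx (subst (_< K) (sym fx≡fy) (rest-< y<N))

    bounded : ∀ {x} → x < suc p + K → f x < suc p + K
    bounded {x} x<N with position p x
    ... | inDescent a<p = <-trans (descent-< a<p) (n<1+n (p + K))
    ... | atPeak        = subst (_< suc p + K) (sym peak) (n<1+n (p + K))
    ... | inRest j      = <-≤-trans (rest-< x<N) (m≤n+m K (suc p))

    injective : InjectiveBelow K g → InjectiveBelow (suc p + K) f
    injective g-injective {x} {y} x<N y<N fx≡fy with position p x | position p y
    ... | inDescent a<p | inDescent b<p = suc-injective (+-cancelˡ-≡ (f x) _ _ (begin
      f x + suc x  ≡⟨ descent a<p ⟩
      p + K        ≡⟨ descent b<p ⟨
      f y + suc y  ≡⟨ cong (_+ suc y) fx≡fy ⟨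
      f x + suc y  ∎))
      where open ≡-Reasoning
    ... | inDescent a<p | atPeak        = ⊥-elim (<-irrefl (trans fx≡fy peak) (descent-< a<p))
    ... | atPeak        | inDescent b<p = ⊥-elim (<-irrefl (trans (sym fx≡fy) peak) (descent-< b<p))
    ... | atPeak        | atPeak        = refl
    ... | inDescent a<p | inRest _      = ⊥-elim (rest-apart (descent-≥ a<p) fx≡fy y<N)
    ... | inRest _      | inDescent b<p = ⊥-elim (rest-apart (descent-≥ b<p) (sym fx≡fy) x<N)
    ... | atPeak        | inRest _      = ⊥-elim (rest-apart peak-≥ fx≡fy y<N)
    ... | inRest _      | atPeak        = ⊥-elim (rest-apart peak-≥ (sym fx≡fy) x<N)
    ... | inRest i      | inRest j      = cong (suc p +_) (g-injective
      (+-cancelˡ-< (suc p) i K x<N) (+-cancelˡ-< (suc p) j K y<N) (trans (sym (rest i)) (trans fx≡fy (rest j))))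

    noTwoLargerLater : NoTwoLargerLater K g → NoTwoLargerLater (suc p + K) f
    noTwoLargerLater g-noTwo {a} {b} {c} a<b b<c c<N fa<fb fa<fc with position p a
    ... | inDescent a<p =
      <-irrefl (trans (onlyPeak a<b b<N fa<fb) (sym (onlyPeak (<-trans a<b b<c) c<N fa<fc))) b<c
      where
      b<N : b < suc p + K
      b<N = <-trans b<c c<N
      onlyPeak : ∀ {x} → a < x → x < suc p + K → f a < f x → x ≡ p
      onlyPeak {x} a<x x<N fa<fx with position p x
      ... | inDescent x<p =
        ⊥-elim (<-asym fa<fx (+-trade-< (trans (descent a<p) (sym (descent x<p))) (s<s a<x)))
      ... | atPeak        = refl
      ... | inRest _      = ⊥-elim (≤⇒≯ (descent-≥ a<p) (<-trans fa<fx (rest-< x<N)))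
    ... | atPeak = <⇒≱ fa<fb (subst (f b ≤_) (sym peak) (≤-pred (bounded (<-trans b<c c<N))))
    ... | inRest a′ with m+n<o⇒∃[o′]o≡m+o′ (suc p) a<b | m+n<o⇒∃[o′]o≡m+o′ (suc p) (<-trans a<b b<c)
    ... | b′ , refl , a′<b′ | c′ , refl , a′<c′ =
      g-noTwo a′<b′ (+-cancelˡ-< (suc p) b′ c′ b<c) (+-cancelˡ-< (suc p) c′ K c<N)
        (subst₂ _<_ (rest a′) (rest b′) fa<fb) (subst₂ _<_ (rest a′) (rest c′) fa<fc)

firstBlock-unique : ∀ {p K f g f′ g′} → FirstBlock p K f g → FirstBlock p K f′ g′ →
  (∀ {j} → j < K → g j ≡ g′ j) → ∀ {x} → x < suc p + K → f x ≡ f′ x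
firstBlock-unique {p} {K} b b′ g≡g′ {x} x<N with position p x
... | inDescent a<p =
  +-cancelʳ-≡ (suc x) _ _ (trans (FirstBlock.descent b a<p) (sym (FirstBlock.descent b′ a<p)))
... | atPeak        = trans (FirstBlock.peak b) (sym (FirstBlock.peak b′))
... | inRest j      =
  trans (FirstBlock.rest b j) (trans (g≡g′ (+-cancelˡ-< (suc p) j K x<N)) (sym (FirstBlock.rest b′ j)))

module PeelFirstBlock {p K f} (perm : Permutes (suc (p + K)) f) (noTwo : NoTwoLargerLater (suc (p + K)) f)
                      (peak : f p ≡ p + K) where
  open Permutes perm

  private
    M : ℕ
    M = p + K
    p<N : p < suc M
    p<N = s≤s (m≤m+n p K)

  module _ {a} (earlier : ∀ {a′} → a′ < a → a′ < p → f a′ + suc a′ ≡ M) (a<p : a < p) where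
    private
      a<N : a < suc M
      a<N = <-trans a<p p<N
      w : ℕ
      w = M ∸ suc a
      w+suc-a≡M : w + suc a ≡ M
      w+suc-a≡M = m∸n+n≡m (<-≤-trans a<p (m≤m+n p K))
      w<M : w < M
      w<M = m+suc[n]≡o⇒m<o w+suc-a≡M

    -- Every value strictly between w and M is already taken by an earlier entry of the descent.
    fa≯w : ¬ w < f a
    fa≯w w<fa = <-irrefl (injective (<-trans a′<a a<N) a<N fa′≡fa) a′<a
      where
      fa<M : f a < M
      fa<M = ≤∧≢⇒< (≤-pred (bounded a<N))
        (λ fa≡M → <-irrefl (injective a<N p<N (trans fa≡M (sym peak))) a<p)
      a′ : ℕ
      a′ = M ∸ suc (f a)
      fa+suc-a′≡M : f a + suc a′ ≡ M
      fa+suc-a′≡M = trans (+-suc (f a) a′) (m+[n∸m]≡n fa<M)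
      a′<a : a′ < a
      a′<a = ≰⇒> λ a≤a′ → <⇒≱ w<fa (+-trade-≤ (trans w+suc-a≡M (sym fa+suc-a′≡M)) (s≤s a≤a′))
      fa′≡fa : f a′ ≡ f a
      fa′≡fa = +-cancelʳ-≡ (suc a′) _ _ (trans (earlier a′<a (<-trans a′<a a<p)) (sym fa+suc-a′≡M))

    -- If f a < w, the entry w would lie after a: a second entry above f a besides the maximum.
    fa≮w : ¬ f a < w
    fa≮w fa<w with surjective (s≤s (m∸n≤m M (suc a)))
    ... | c , c<N , fc≡w with <-cmp c a
    ... | tri< c<a _ _ = <-irrefl c≡a c<a
      where
      c≡a : c ≡ a
      c≡a = suc-injective (+-cancelˡ-≡ w _ _
              (trans (cong (_+ suc c) (sym fc≡w)) (trans (earlier c<a (<-trans c<a a<p)) (sym w+suc-a≡M))))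
    ... | tri≈ _ refl _ = <-irrefl fc≡w fa<w
    ... | tri> _ _ a<c = noTwoLargerLater-unordered noTwo a<c a<p c≢p c<N p<N
                           (subst (f a <_) (sym fc≡w) fa<w) (subst (f a <_) (sym peak) (<-trans fa<w w<M))
      where
      c≢p : c ≢ p
      c≢p c≡p = <-irrefl (trans (sym fc≡w) (trans (cong f c≡p) peak)) w<M

    descent-step : f a + suc a ≡ M
    descent-step with <-cmp (f a) w
    ... | tri≈ _ fa≡w _ = trans (cong (_+ suc a) fa≡w) w+suc-a≡M
    ... | tri> _ _ w<fa = ⊥-elim (fa≯w w<fa)
    ... | tri< fa<w _ _ = ⊥-elim (fa≮w fa<w)

  descent : ∀ {a} → a < p → f a + suc a ≡ M
  descent {a} = <-rec (λ a → a < p → f a + suc a ≡ M) (λ _ earlier → descent-step earlier) a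

  isFirstBlock : FirstBlock p K f (f ∘ (suc p +_))
  isFirstBlock = record { descent = descent ; peak = peak ; rest = λ _ → refl }

  open FirstBlockProperties isFirstBlock using (descent-≥; peak-≥)

  descent-covers : ∀ {v} → K ≤ v → v < M → ∃[ a ] a < p × f a ≡ v
  descent-covers {v} K≤v v<M = a , a<p , +-cancelʳ-≡ (suc a) _ _ (trans (descent a<p) (sym v+suc-a≡M))
    where
    a : ℕ
    a = M ∸ suc v
    v+suc-a≡M : v + suc a ≡ M
    v+suc-a≡M = trans (+-suc v a) (m+[n∸m]≡n v<M)
    a<p : a < p
    a<p = ≮⇒≥ (λ p<suc-a → <⇒≱ (+-trade-< (trans (+-comm K p) (sym v+suc-a≡M)) p<suc-a) K≤v)

  restPermutes : Permutes K (f ∘ (suc p +_))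
  restPermutes = record { bounded = rest-bounded ; injective = rest-injective ; surjective = rest-surjective }
    where
    rest-bounded : ∀ {j} → j < K → f (suc p + j) < K
    rest-bounded {j} j<K = ≰⇒> K≰fx
      where
      x<N : suc p + j < suc M
      x<N = +-monoʳ-< (suc p) j<K
      p<x : p < suc p + j
      p<x = s≤s (m≤m+n p j)
      fx<M : f (suc p + j) < M
      fx<M = ≤∧≢⇒< (≤-pred (bounded x<N))
        (λ fx≡M → <-irrefl (injective p<N x<N (trans peak (sym fx≡M))) p<x)
      K≰fx : ¬ K ≤ f (suc p + j)
      K≰fx K≤fx with descent-covers K≤fx fx<M
      ... | a , a<p , fa≡fx = <-irrefl (injective (<-trans a<p p<N) x<N fa≡fx) (<-trans a<p p<x)
    rest-injective : InjectiveBelow K (f ∘ (suc p +_))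
    rest-injective i<K j<K e =
      +-cancelˡ-≡ (suc p) _ _ (injective (+-monoʳ-< (suc p) i<K) (+-monoʳ-< (suc p) j<K) e)
    rest-surjective : ∀ {w} → w < K → ∃[ j ] j < K × f (suc p + j) ≡ w
    rest-surjective w<K with surjective (<-≤-trans w<K (m≤n+m K (suc p)))
    ... | c , c<N , fc≡w with position p c
    ... | inDescent a<p = ⊥-elim (≤⇒≯ (descent-≥ a<p) (subst (_< K) (sym fc≡w) w<K))
    ... | atPeak        = ⊥-elim (≤⇒≯ peak-≥ (subst (_< K) (sym fc≡w) w<K))
    ... | inRest j      = j , +-cancelˡ-< (suc p) j K c<N , fc≡w

peelFirstBlock : ∀ {M f} → Permutes (suc M) f → NoTwoLargerLater (suc M) f →
  ∃₂ λ p K → p + K ≡ M × FirstBlock p K f (f ∘ (suc p +_)) × Permutes K (f ∘ (suc p +_))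
peelFirstBlock {M} perm noTwo with Permutes.surjective perm (n<1+n M)
... | p , p<N , peak with m≤n⇒∃[o]m+o≡n (≤-pred p<N)
... | K , refl = p , K , refl , isFirstBlock , restPermutes
  where open PeelFirstBlock perm noTwo peak

module _ {p K i f g} (b : FirstBlock p K f g) (alt : Alternates i (suc p + K) f) where
  open FirstBlock b

  firstBlock-restParity : parity K ≡ parity i
  firstBlock-restParity = parity-cancelˡ p K i (begin
    parity (p + K)  ≡⟨ cong parity peak ⟨
    parity (f p)    ≡⟨ parity-≡ alt (s≤s (m≤m+n p K)) ⟩
    parity (i + p)  ≡⟨ cong parity (+-comm i p) ⟩
    parity (p + i)  ∎)
    where open ≡-Reasoning

  firstBlock-lengthParity : parity (i + suc (p + K)) ≡ parity (suc p)
  firstBlock-lengthParity = begin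
    parity (i + suc (p + K))           ≡⟨ cong parity (trans (+-comm i (suc (p + K))) (cong suc (+-assoc p K i))) ⟩
    parity (suc p + (K + i))           ≡⟨ ℙ.+-homo-+ (suc p) (K + i) ⟩
    parity (suc p) ℙ.+ parity (K + i)  ≡⟨ cong (parity (suc p) ℙ.+_) K+i-even ⟩
    parity (suc p) ℙ.+ 0ℙ              ≡⟨ ℙ.+-identityʳ (parity (suc p)) ⟩
    parity (suc p)                     ∎
    where
    open ≡-Reasoning
    K+i-even : parity (K + i) ≡ 0ℙ
    K+i-even = trans (ℙ.+-homo-+ K i)
      (trans (cong (ℙ._+ parity i) firstBlock-restParity) (ℙ.p+p≡0ℙ (parity i)))

firstBlock-shape : ∀ {p K i f g} → FirstBlock p K f g → Alternates i (suc p + K) f →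
  p ≡ 0 ⊎ parity p ≡ 1ℙ
firstBlock-shape {zero}              _ _   = inj₁ refl
firstBlock-shape {suc p} {K} {i} {f} b alt = inj₂ (trans (parity-suc p) (cong _⁻¹ p-even))
  where
  open FirstBlock b
  f0≡p+K : f 0 ≡ p + K
  f0≡p+K = suc-injective (trans (+-comm 1 (f 0)) (descent z<s))
  p-even : parity p ≡ 0ℙ
  p-even = parity-cancelʳ K p 0 (begin
    parity (p + K)  ≡⟨ cong parity f0≡p+K ⟨
    parity (f 0)    ≡⟨ parity-≡ alt z<s ⟩
    parity (i + 0)  ≡⟨ cong parity (+-identityʳ i) ⟩
    parity i        ≡⟨ firstBlock-restParity b alt ⟨
    parity K        ∎)
    where open ≡-Reasoning

firstBlock-alternates : ∀ {p K f g} → FirstBlock p K f g → parity p ≡ 1ℙ → parity K ≡ 0ℙ →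
  Alternates 0 K g → Alternates 0 (suc p + K) f
firstBlock-alternates {p} {K} {f} b p-odd K-even g-alt = alternates alt
  where
  open FirstBlock b
  parity[p+K]≡parity[p] : parity (p + K) ≡ parity p
  parity[p+K]≡parity[p] =
    trans (ℙ.+-homo-+ p K) (trans (cong (parity p ℙ.+_) K-even) (ℙ.+-identityʳ (parity p)))
  parity[suc[p]+j]≡parity[j] : ∀ j → parity (suc p + j) ≡ parity j
  parity[suc[p]+j]≡parity[j] j =
    trans (ℙ.+-homo-+ (suc p) j) (cong (ℙ._+ parity j) (trans (parity-suc p) (cong _⁻¹ p-odd)))
  alt : ∀ {x} → x < suc p + K → parity (f x) ≡ parity x
  alt {x} x<N with position p x
  ... | inDescent a<p = odd-m+suc[n]⇒same-parity (f x) x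
                          (trans (cong parity (descent a<p)) (trans parity[p+K]≡parity[p] p-odd))
  ... | atPeak        = trans (cong parity peak) parity[p+K]≡parity[p]
  ... | inRest j      = trans (cong parity (rest j))
    (trans (parity-≡ g-alt (+-cancelˡ-< (suc p) j K x<N)) (sym (parity[suc[p]+j]≡parity[j] j)))

odd⇒reversal : ∀ {N i f} → Acc _<_ N → Permutes N f → NoTwoLargerLater N f → Alternates i N f →
  parity (i + N) ≡ 1ℙ → IsReversal N f
odd⇒reversal {zero} _ _ _ _ _ ()
odd⇒reversal {suc M} {i} {f} (acc smaller) perm noTwo alt odd with peelFirstBlock perm noTwo
... | p , K , refl , b , rest with firstBlock-shape b alt
... | inj₂ p-odd = ⊥-elim (1ℙ≢0ℙ
  (trans (sym odd) (trans (firstBlock-lengthParity b alt) (trans (parity-suc p) (cong _⁻¹ p-odd)))))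
  where
  1ℙ≢0ℙ : 1ℙ ≢ 0ℙ
  1ℙ≢0ℙ ()
... | inj₁ refl = reversal-cons {f = f} (FirstBlock.peak b)
  (odd⇒reversal (smaller (n<1+n K)) rest (noTwoLargerLater-shift 1 noTwo) (alternates-shift 1 alt)
    (trans (cong parity (+-assoc i 1 K)) odd))

size : List ℕ → ℕ
size ps = sum (map suc ps)

blocks : List ℕ → ℕ → ℕ
blocks []       = λ _ → 0
blocks (p ∷ ps) = block p (size ps) (p + size ps) (blocks ps)

blocks-bounded : ∀ ps {j} → j < size ps → blocks ps j < size ps
blocks-bounded []       ()
blocks-bounded (p ∷ ps) = FirstBlockProperties.bounded (block-firstBlock p) (blocks-bounded ps)

blocks-injective : ∀ ps → InjectiveBelow (size ps) (blocks ps)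
blocks-injective []       ()
blocks-injective (p ∷ ps) =
  FirstBlockProperties.injective (block-firstBlock p) (blocks-bounded ps) (blocks-injective ps)

blocks-noTwoLargerLater : ∀ ps → NoTwoLargerLater (size ps) (blocks ps)
blocks-noTwoLargerLater []       _ _ ()
blocks-noTwoLargerLater (p ∷ ps) =
  FirstBlockProperties.noTwoLargerLater (block-firstBlock p) (blocks-bounded ps) (blocks-noTwoLargerLater ps)

blocks-determined : ∀ ps qs → size ps ≡ size qs →
  (∀ {j} → j < size ps → blocks ps j ≡ blocks qs j) → ps ≡ qs
blocks-determined []       []       _  _     = refl
blocks-determined (p ∷ ps) (q ∷ qs) eq agree = cong₂ _∷_ (sym q≡p) (blocks-determined ps qs K≡L rest-agree)
  where
  open FirstBlock
  q<N : q < size (p ∷ ps)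
  q<N = subst (q <_) (sym eq) (s≤s (m≤m+n q (size qs)))
  -- both first blocks end at the position of the largest entry
  q≡p : q ≡ p
  q≡p = blocks-injective (p ∷ ps) q<N (s≤s (m≤m+n p (size ps))) (begin
    blocks (p ∷ ps) q  ≡⟨ agree q<N ⟩
    blocks (q ∷ qs) q  ≡⟨ peak (block-firstBlock q) ⟩
    q + size qs        ≡⟨ suc-injective eq ⟨
    p + size ps        ≡⟨ peak (block-firstBlock p) ⟨
    blocks (p ∷ ps) p  ∎)
    where open ≡-Reasoning
  K≡L : size ps ≡ size qs
  K≡L = +-cancelˡ-≡ p _ _ (trans (suc-injective eq) (cong (_+ size qs) q≡p))
  rest-agree : ∀ {j} → j < size ps → blocks ps j ≡ blocks qs j
  rest-agree {j} j<K = begin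
    blocks ps j                  ≡⟨ rest (block-firstBlock p) j ⟨
    blocks (p ∷ ps) (suc p + j)  ≡⟨ agree (+-monoʳ-< (suc p) j<K) ⟩
    blocks (q ∷ qs) (suc p + j)  ≡⟨ cong (λ r → blocks (q ∷ qs) (suc r + j)) q≡p ⟨
    blocks (q ∷ qs) (suc q + j)  ≡⟨ rest (block-firstBlock q) j ⟩
    blocks qs j                  ∎
    where open ≡-Reasoning

odd : ℕ → ℕ
odd r = suc (r + r)

evenBlocks : List ℕ → ℕ → ℕ
evenBlocks rs = blocks (map odd rs)

size-map-odd : ∀ rs → size (map odd rs) ≡ size rs + size rs
size-map-odd []       = refl
size-map-odd (r ∷ rs) = trans (cong (suc (odd r) +_) (size-map-odd rs)) (regroup r (size rs))
  where
  regroup : ∀ r s → suc (suc (r + r)) + (s + s) ≡ (suc r + s) + (suc r + s)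
  regroup = solve-∀

evenBlocks-alternates : ∀ rs → Alternates 0 (size (map odd rs)) (evenBlocks rs)
evenBlocks-alternates []       = alternates λ ()
evenBlocks-alternates (r ∷ rs) = firstBlock-alternates (block-firstBlock (odd r))
  (trans (parity-suc (r + r)) (cong _⁻¹ (parity-double r)))
  (trans (cong parity (size-map-odd rs)) (parity-double (size rs)))
  (evenBlocks-alternates rs)

even⇒evenBlocks : ∀ {N i f} → Acc _<_ N → Permutes N f → NoTwoLargerLater N f → Alternates i N f →
  parity (i + N) ≡ 0ℙ → ∃[ rs ] size (map odd rs) ≡ N × (∀ {j} → j < N → f j ≡ evenBlocks rs j)
even⇒evenBlocks {zero} _ _ _ _ _ = [] , refl , λ ()
even⇒evenBlocks {suc M} {i} {f} (acc smaller) perm noTwo alt even with peelFirstBlock perm noTwo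
... | p , K , refl , b , rest with firstBlock-shape b alt
... | inj₁ refl = ⊥-elim (0ℙ≢1ℙ (trans (sym even) (firstBlock-lengthParity b alt)))
  where
  0ℙ≢1ℙ : 0ℙ ≢ 1ℙ
  0ℙ≢1ℙ ()
... | inj₂ p-odd with odd⇒≡suc[r+r] p p-odd
... | r , refl with even⇒evenBlocks (smaller (s≤s (m≤n+m K p))) rest (noTwoLargerLater-shift (suc p) noTwo)
                      (alternates-shift (suc p) alt) (trans (cong parity (+-assoc i (suc p) K)) even)
... | rs , refl , agree = r ∷ rs , refl , firstBlock-unique b (block-firstBlock p) agree

-- Compositions

incrHead : List ℕ → List ℕ
incrHead []       = []
incrHead (r ∷ rs) = suc r ∷ rs

-- The compositions of m + 1, each part stored minus one.
compositions : ℕ → List (List ℕ)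
compositions zero    = (0 ∷ []) ∷ []
compositions (suc m) = map (0 ∷_) (compositions m) ++ map incrHead (compositions m)

compositions-size : ∀ m {rs} → rs ∈ compositions m → size rs ≡ suc m
compositions-size zero    (here refl) = refl
compositions-size (suc m) rs∈ with ∈-++⁻ (map (0 ∷_) (compositions m)) rs∈
... | inj₁ rs∈₁ with ∈-map⁻ (0 ∷_) rs∈₁
...   | _ , rs′∈ , refl = cong suc (compositions-size m rs′∈)
compositions-size (suc m) rs∈ | inj₂ rs∈₂ with ∈-map⁻ incrHead rs∈₂
... | _ ∷ _ , rs′∈ , refl = cong suc (compositions-size m rs′∈)
... | []    , rs′∈ , refl with compositions-size m rs′∈
...   | ()

compositions-complete : ∀ m rs → size rs ≡ suc m → rs ∈ compositions m
compositions-complete zero    (zero ∷ [])  refl = here refl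
compositions-complete (suc m) (zero ∷ rs)  eq   =
  ∈-++⁺ˡ (∈-map⁺ (0 ∷_) (compositions-complete m rs (suc-injective eq)))
compositions-complete (suc m) (suc r ∷ rs) eq   = ∈-++⁺ʳ (map (0 ∷_) (compositions m))
  (∈-map⁺ incrHead (compositions-complete m (r ∷ rs) (suc-injective eq)))

compositions-unique : ∀ m → Unique (compositions m)
compositions-unique zero    = All.[] AllPairs.∷ AllPairs.[]
compositions-unique (suc m) = Unique.++⁺ (Unique.map⁺ cons-injective (compositions-unique m))
                                         (Unique.map⁺ incrHead-injective (compositions-unique m)) disjoint
  where
  cons-injective : ∀ {rs qs : List ℕ} → 0 ∷ rs ≡ 0 ∷ qs → rs ≡ qs
  cons-injective refl = refl
  incrHead-injective : ∀ {rs qs} → incrHead rs ≡ incrHead qs → rs ≡ qs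
  incrHead-injective {[]}    {[]}    _    = refl
  incrHead-injective {_ ∷ _} {_ ∷ _} refl = refl
  disjoint : ∀ {rs} → ¬ (rs ∈ map (0 ∷_) (compositions m) × rs ∈ map incrHead (compositions m))
  disjoint (rs∈₁ , rs∈₂) with ∈-map⁻ (0 ∷_) rs∈₁ | ∈-map⁻ incrHead rs∈₂
  ... | _ , _ , refl | []    , _ , ()
  ... | _ , _ , refl | _ ∷ _ , _ , ()

length-compositions : ∀ m → length (compositions m) ≡ 2 ^ m
length-compositions zero    = refl
length-compositions (suc m) = begin
  length (map (0 ∷_) cs ++ map incrHead cs)
    ≡⟨ length-++ (map (0 ∷_) cs) ⟩
  length (map (0 ∷_) cs) + length (map incrHead cs)
    ≡⟨ cong₂ _+_ (length-map (0 ∷_) cs) (length-map incrHead cs) ⟩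
  length cs + length cs
    ≡⟨ cong₂ _+_ (length-compositions m) (length-compositions m) ⟩
  2 ^ m + 2 ^ m
    ≡⟨ cong (2 ^ m +_) (+-identityʳ (2 ^ m)) ⟨
  2 ^ suc m
    ∎
  where
  open ≡-Reasoning
  cs : List (List ℕ)
  cs = compositions m

Unique-map⁺ : ∀ {A B : Set} {f : A → B} {xs} →
  (∀ {x y} → x ∈ xs → y ∈ xs → f x ≡ f y → x ≡ y) → Unique xs → Unique (map f xs)
Unique-map⁺ {xs = []}     _   AllPairs.[]                 = AllPairs.[]
Unique-map⁺ {xs = x ∷ xs} inj (x∉xs AllPairs.∷ xs-unique) =
  All.map⁺ (All.tabulate λ y∈xs fx≡fy → All.lookup x∉xs y∈xs (inj (here refl) (there y∈xs) fx≡fy))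
  AllPairs.∷ Unique-map⁺ (λ x∈xs y∈xs → inj (there x∈xs) (there y∈xs)) xs-unique

-- Words over Fin n

parity-bit : Parity → ℕ
parity-bit 0ℙ = 0
parity-bit 1ℙ = 1

%2≡parity-bit : ∀ n → n % 2 ≡ parity-bit (parity n)
%2≡parity-bit zero          = refl
%2≡parity-bit (suc zero)    = refl
%2≡parity-bit (suc (suc n)) = %2≡parity-bit n

%2≡⇔parity≡ : ∀ m n → (m % 2 ≡ n % 2) ⇔ (parity m ≡ parity n)
%2≡⇔parity≡ m n = mk⇔
  (λ eq → bit-injective (trans (sym (%2≡parity-bit m)) (trans eq (%2≡parity-bit n))))
  (λ eq → trans (%2≡parity-bit m) (trans (cong parity-bit eq) (sym (%2≡parity-bit n))))
  where
  bit-injective : ∀ {x y} → parity-bit x ≡ parity-bit y → x ≡ y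
  bit-injective {0ℙ} {0ℙ} _ = refl
  bit-injective {1ℙ} {1ℙ} _ = refl

injective⇒surjective : ∀ {n} {h : Fin n → Fin n} → Injective _≡_ _≡_ h → ∀ y → ∃[ x ] h x ≡ y
injective⇒surjective {suc n} {h} h-injective y with any? (λ x → h x Fin.≟ y)
... | yes hit  = hit
... | no  miss = ⊥-elim (<-irrefl refl (injective⇒≤ squeeze-injective))
  where
  y≢h : ∀ x → y ≢ h x
  y≢h x y≡hx = miss (x , sym y≡hx)
  squeeze : Fin (suc n) → Fin n
  squeeze x = punchOut (y≢h x)
  squeeze-injective : Injective _≡_ _≡_ squeeze
  squeeze-injective e = h-injective (punchOut-injective (y≢h _) (y≢h _) e)

StrictlyIncreasing : ∀ {k n} → (Fin k → Fin n) → Set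
StrictlyIncreasing h = ∀ {i j} → i Fin.< j → h i Fin.< h j

increasing-reflects : ∀ {k n} {h : Fin k → Fin n} → StrictlyIncreasing h →
  ∀ {i j} → h i Fin.< h j → i Fin.< j
increasing-reflects h↑ {i} {j} hi<hj with Fin.<-cmp i j
... | tri< i<j _ _ = i<j
... | tri≈ _ refl _ = ⊥-elim (Fin.<-irrefl refl hi<hj)
... | tri> _ _ j<i = ⊥-elim (Fin.<-asym hi<hj (h↑ j<i))

increasing₃ : ∀ {n} {x y z : Fin n} → x Fin.< y → y Fin.< z →
  StrictlyIncreasing (lookup (x ∷ y ∷ z ∷ []))
increasing₃ x<y y<z {fzero}      {fsuc fzero}        _ = x<y
increasing₃ x<y y<z {fzero}      {fsuc (fsuc fzero)} _ = Fin.<-trans x<y y<z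
increasing₃ x<y y<z {fsuc fzero} {fsuc (fsuc fzero)} _ = y<z
increasing₃ _   _   {fzero}             {fzero}             ()
increasing₃ _   _   {fsuc _}            {fzero}             ()
increasing₃ _   _   {fsuc fzero}        {fsuc fzero}        (s<s ())
increasing₃ _   _   {fsuc (fsuc fzero)} {fsuc fzero}        (s<s ())
increasing₃ _   _   {fsuc (fsuc fzero)} {fsuc (fsuc fzero)} (s<s (s<s ()))

contains : ∀ {n k} {π : Vec (Fin n) n} {σ : Vec (Fin k) k} (g h : Fin k → Fin n) →
  StrictlyIncreasing g → StrictlyIncreasing h → (∀ i → lookup π (g i) ≡ h (lookup σ i)) → Contains π σ
contains g h g↑ h↑ π∘g≡h∘σ = g , (λ _ _ → g↑) , λ i j → mk⇔
  (λ σi<σj → subst₂ Fin._<_ (sym (π∘g≡h∘σ i)) (sym (π∘g≡h∘σ j)) (h↑ σi<σj))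
  (λ πgi<πgj → increasing-reflects h↑ (subst₂ Fin._<_ (π∘g≡h∘σ i) (π∘g≡h∘σ j) πgi<πgj))

twoLargerLater⇒contains : ∀ {n} {π : Vec (Fin n) n} → IsPerm π → ∀ {x y z} → x Fin.< y → y Fin.< z →
  lookup π x Fin.< lookup π y → lookup π x Fin.< lookup π z → Contains π p123 ⊎ Contains π p132
twoLargerLater⇒contains {π = π} perm {x} {y} {z} x<y y<z πx<πy πx<πz
  with Fin.<-cmp (lookup π y) (lookup π z)
... | tri< πy<πz _ _ = inj₁ (contains {π = π} {σ = p123} _ (lookup (lookup π x ∷ lookup π y ∷ lookup π z ∷ []))
  (increasing₃ x<y y<z) (increasing₃ πx<πy πy<πz)
  λ { fzero → refl ; (fsuc fzero) → refl ; (fsuc (fsuc fzero)) → refl })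
... | tri≈ _ πy≡πz _ = ⊥-elim (Fin.<-irrefl (perm πy≡πz) y<z)
... | tri> _ _ πz<πy = inj₂ (contains {π = π} {σ = p132} _ (lookup (lookup π x ∷ lookup π z ∷ lookup π y ∷ []))
  (increasing₃ x<y y<z) (increasing₃ πx<πz πz<πy)
  λ { fzero → refl ; (fsuc fzero) → refl ; (fsuc (fsuc fzero)) → refl })

record Encodes {n} (π : Vec (Fin n) n) (f : ℕ → ℕ) : Set where
  constructor encodes
  field entry : ∀ x → toℕ (lookup π x) ≡ f (toℕ x)

entries : ∀ {n} → Vec (Fin n) n → ℕ → ℕ
entries {n} π j with j <? n
... | yes j<n = toℕ (lookup π (fromℕ< j<n))
... | no  _   = 0

entries-encodes : ∀ {n} (π : Vec (Fin n) n) → Encodes π (entries π)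
entries-encodes {n} π = encodes entry
  where
  entry : ∀ x → toℕ (lookup π x) ≡ entries π (toℕ x)
  entry x with toℕ x <? n
  ... | yes x<n = cong (toℕ ∘ lookup π) (sym (fromℕ<-toℕ x x<n))
  ... | no  x≮n = ⊥-elim (x≮n (toℕ<n x))

-- Reducing mod n only serves to land in Fin n: it does nothing to the entries of a bounded f.
fromFunction : ∀ n .{{_ : NonZero n}} → (ℕ → ℕ) → Vec (Fin n) n
fromFunction n f = tabulate (λ x → f (toℕ x) mod n)

fromFunction-encodes : ∀ {n} .{{_ : NonZero n}} {f} → (∀ {j} → j < n → f j < n) →
  Encodes (fromFunction n f) f
fromFunction-encodes {n} {f} bounded = encodes λ x → begin
  toℕ (lookup (fromFunction n f) x)  ≡⟨ cong toℕ (lookup∘tabulate _ x) ⟩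
  toℕ (f (toℕ x) mod n)              ≡⟨ toℕ-fromℕ< _ ⟩
  f (toℕ x) % n                      ≡⟨ m<n⇒m%n≡m (bounded (toℕ<n x)) ⟩
  f (toℕ x)                          ∎
  where open ≡-Reasoning

encodes-≡ : ∀ {n} {π π′ : Vec (Fin n) n} {f g} → Encodes π f → Encodes π′ g →
  (∀ {j} → j < n → f j ≡ g j) → π ≡ π′
encodes-≡ {π = π} {π′} (encodes enc) (encodes enc′) f≡g = begin
  π                     ≡⟨ tabulate∘lookup π ⟨
  tabulate (lookup π)   ≡⟨ tabulate-cong (λ x → toℕ-injective
                             (trans (enc x) (trans (f≡g (toℕ<n x)) (sym (enc′ x))))) ⟩
  tabulate (lookup π′)  ≡⟨ tabulate∘lookup π′ ⟩
  π′                    ∎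
  where open ≡-Reasoning

module Encoding {n} {π : Vec (Fin n) n} {f : ℕ → ℕ} (encoding : Encodes π f) where
  open Encodes encoding renaming (entry to enc)

  at : ∀ {j} (j<n : j < n) → toℕ (lookup π (fromℕ< j<n)) ≡ f j
  at j<n = trans (enc _) (cong f (toℕ-fromℕ< j<n))

  bounded : ∀ {j} → j < n → f j < n
  bounded j<n = subst (_< n) (at j<n) (toℕ<n _)

  injectiveBelow : IsPerm π → InjectiveBelow n f
  injectiveBelow perm {a} {b} a<n b<n fa≡fb = begin
    a                 ≡⟨ toℕ-fromℕ< a<n ⟨
    toℕ (fromℕ< a<n)  ≡⟨ cong toℕ (perm (toℕ-injective (trans (at a<n) (trans fa≡fb (sym (at b<n)))))) ⟩
    toℕ (fromℕ< b<n)  ≡⟨ toℕ-fromℕ< b<n ⟩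
    b                 ∎
    where open ≡-Reasoning

  isPerm : InjectiveBelow n f → IsPerm π
  isPerm injective {x} {y} πx≡πy =
    toℕ-injective (injective (toℕ<n x) (toℕ<n y) (trans (sym (enc x)) (trans (cong toℕ πx≡πy) (enc y))))

  permutes : IsPerm π → Permutes n f
  permutes perm = record { bounded = bounded ; injective = injectiveBelow perm ; surjective = surjective }
    where
    surjective : ∀ {w} → w < n → ∃[ a ] a < n × f a ≡ w
    surjective w<n with injective⇒surjective {h = lookup π} perm (fromℕ< w<n)
    ... | x , πx≡w = toℕ x , toℕ<n x , trans (sym (enc x)) (trans (cong toℕ πx≡w) (toℕ-fromℕ< w<n))

  alternates⇔ : (∀ x → toℕ (lookup π x) % 2 ≡ toℕ x % 2) ⇔ Alternates 0 n f
  alternates⇔ = mk⇔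
    (λ par → alternates λ {j} j<n → begin
      parity (f j)                          ≡⟨ cong parity (at j<n) ⟨
      parity (toℕ (lookup π (fromℕ< j<n)))  ≡⟨ same-parity (par (fromℕ< j<n)) ⟩
      parity (toℕ (fromℕ< j<n))             ≡⟨ cong parity (toℕ-fromℕ< j<n) ⟩
      parity j                              ∎)
    (λ alt x → Equivalence.from (%2≡⇔parity≡ (toℕ (lookup π x)) (toℕ x))
                 (trans (cong parity (enc x)) (parity-≡ alt (toℕ<n x))))
    where
    open ≡-Reasoning
    same-parity : ∀ {x} → toℕ (lookup π x) % 2 ≡ toℕ x % 2 →
      parity (toℕ (lookup π x)) ≡ parity (toℕ x)
    same-parity {x} = Equivalence.to (%2≡⇔parity≡ (toℕ (lookup π x)) (toℕ x))

  avoids : NoTwoLargerLater n f → (σ : Vec (Fin 3) 3) →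
    lookup σ fzero Fin.< lookup σ (fsuc fzero) → lookup σ fzero Fin.< lookup σ (fsuc (fsuc fzero)) → Avoids π σ
  avoids noTwo σ σ₀<σ₁ σ₀<σ₂ (g , g↑ , iso) =
    noTwo (g↑ _ _ z<s) (g↑ _ _ (s<s z<s)) (toℕ<n (g (fsuc (fsuc fzero)))) (larger σ₀<σ₁) (larger σ₀<σ₂)
    where
    larger : ∀ {i j} → lookup σ i Fin.< lookup σ j → f (toℕ (g i)) < f (toℕ (g j))
    larger {i} {j} σi<σj = subst₂ _<_ (enc (g i)) (enc (g j)) (Equivalence.to (iso i j) σi<σj)

  noTwoLargerLater : IsPerm π → Avoids π p132 → Avoids π p123 → NoTwoLargerLater n f
  noTwoLargerLater perm avoids132 avoids123 {a} {b} {c} a<b b<c c<n fa<fb fa<fc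
    with twoLargerLater⇒contains {π = π} perm (index a<n b<n a<b) (index b<n c<n b<c)
                                              (value a<n b<n fa<fb) (value a<n c<n fa<fc)
    where
    b<n : b < n
    b<n = <-trans b<c c<n
    a<n : a < n
    a<n = <-trans a<b b<n
    index : ∀ {u v} (u<n : u < n) (v<n : v < n) → u < v → fromℕ< u<n Fin.< fromℕ< v<n
    index u<n v<n = subst₂ _<_ (sym (toℕ-fromℕ< u<n)) (sym (toℕ-fromℕ< v<n))
    value : ∀ {u v} (u<n : u < n) (v<n : v < n) → f u < f v →
      lookup π (fromℕ< u<n) Fin.< lookup π (fromℕ< v<n)
    value u<n v<n = subst₂ _<_ (sym (at u<n)) (sym (at v<n))
  ... | inj₁ contains123 = avoids123 contains123
  ... | inj₂ contains132 = avoids132 contains132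

  isPAPAvoiding⇒ : IsPAPAvoiding p132 p123 π → Permutes n f × NoTwoLargerLater n f × Alternates 0 n f
  isPAPAvoiding⇒ ((perm , par) , avoids132 , avoids123) =
    permutes perm , noTwoLargerLater perm avoids132 avoids123 , Equivalence.to alternates⇔ par

  ⇒isPAPAvoiding : InjectiveBelow n f → NoTwoLargerLater n f → Alternates 0 n f → IsPAPAvoiding p132 p123 π
  ⇒isPAPAvoiding injective noTwo alt =
    (isPerm injective , Equivalence.from alternates⇔ alt) , avoids noTwo p132 z<s z<s , avoids noTwo p123 z<s z<s

decreasing-encodes : ∀ N → Encodes (decreasing N) (λ j → N ∸ suc j)
decreasing-encodes N = encodes λ x → trans (cong toℕ (lookup∘tabulate opposite x)) (opposite-prop x)

decreasing-isReversal : ∀ N → IsReversal N (λ j → N ∸ suc j)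
decreasing-isReversal N j<N = m∸n+n≡m j<N

decreasing-isPAPAvoiding : ∀ {N} → parity N ≡ 1ℙ → IsPAPAvoiding p132 p123 (decreasing N)
decreasing-isPAPAvoiding {N} N-odd =
  ⇒isPAPAvoiding (reversal-injective rev) (reversal-noTwoLargerLater rev) (reversal-alternates rev N-odd)
  where
  open Encoding (decreasing-encodes N)
  rev : IsReversal N (λ j → N ∸ suc j)
  rev = decreasing-isReversal N

isPAPAvoiding⇒decreasing : ∀ {N} → parity N ≡ 1ℙ → (π : Vec (Fin N) N) →
  IsPAPAvoiding p132 p123 π → π ≡ decreasing N
isPAPAvoiding⇒decreasing {N} N-odd π avoiding with Encoding.isPAPAvoiding⇒ (entries-encodes π) avoiding
... | perm , noTwo , alt = encodes-≡ (entries-encodes π) (decreasing-encodes N)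
  λ j<N → +-cancelʳ-≡ _ _ _ (trans (rev j<N) (sym (decreasing-isReversal N j<N)))
  where
  rev : IsReversal N (entries π)
  rev = odd⇒reversal (<-wellFounded N) perm noTwo alt N-odd

module EvenLength (m : ℕ) where

  n : ℕ
  n = 2 * suc m

  permutation : List ℕ → Vec (Fin n) n
  permutation rs = fromFunction n (evenBlocks rs)

  module _ (rs : List ℕ) (composition : size rs ≡ suc m) where

    size≡n : size (map odd rs) ≡ n
    size≡n = trans (size-map-odd rs)
      (trans (cong (λ s → s + s) composition) (cong (suc m +_) (sym (+-identityʳ (suc m)))))

    permutation-encodes : Encodes (permutation rs) (evenBlocks rs)
    permutation-encodes = fromFunction-encodes λ {j} j<n →
      subst (evenBlocks rs j <_) size≡n (blocks-bounded (map odd rs) (subst (j <_) (sym size≡n) j<n))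

    permutation-isPAPAvoiding : IsPAPAvoiding p132 p123 (permutation rs)
    permutation-isPAPAvoiding = ⇒isPAPAvoiding
      (subst (λ N → InjectiveBelow N (evenBlocks rs)) size≡n (blocks-injective (map odd rs)))
      (subst (λ N → NoTwoLargerLater N (evenBlocks rs)) size≡n (blocks-noTwoLargerLater (map odd rs)))
      (subst (λ N → Alternates 0 N (evenBlocks rs)) size≡n (evenBlocks-alternates rs))
      where open Encoding permutation-encodes

  permutation-injective : ∀ {rs qs} → size rs ≡ suc m → size qs ≡ suc m →
    permutation rs ≡ permutation qs → rs ≡ qs
  permutation-injective {rs} {qs} rs-composition qs-composition eq = map-injective odd-injective
    (blocks-determined (map odd rs) (map odd qs)
      (trans (size≡n rs rs-composition) (sym (size≡n qs qs-composition))) agree)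
    where
    odd-injective : ∀ {r s} → odd r ≡ odd s → r ≡ s
    odd-injective = double-injective ∘ suc-injective
    agree : ∀ {j} → j < size (map odd rs) → evenBlocks rs j ≡ evenBlocks qs j
    agree {j} j<size = begin
      evenBlocks rs j                                ≡⟨ Encoding.at (permutation-encodes rs rs-composition) j<n ⟨
      toℕ (lookup (permutation rs) (fromℕ< j<n))  ≡⟨ cong (λ π → toℕ (lookup π (fromℕ< j<n))) eq ⟩
      toℕ (lookup (permutation qs) (fromℕ< j<n))  ≡⟨ Encoding.at (permutation-encodes qs qs-composition) j<n ⟩
      evenBlocks qs j                                ∎
      where
      open ≡-Reasoning
      j<n : j < n
      j<n = subst (j <_) (size≡n rs rs-composition) j<size

  isPAPAvoiding⇒permutation : ∀ π → IsPAPAvoiding p132 p123 π →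
    ∃[ rs ] size rs ≡ suc m × π ≡ permutation rs
  isPAPAvoiding⇒permutation π avoiding with Encoding.isPAPAvoiding⇒ (entries-encodes π) avoiding
  ... | perm , noTwo , alt with even⇒evenBlocks (<-wellFounded n) perm noTwo alt (ℙ.*-homo-* 2 (suc m))
  ... | rs , size≡ , agree =
    rs , composition , encodes-≡ (entries-encodes π) (permutation-encodes rs composition) agree
    where
    composition : size rs ≡ suc m
    composition = double-injective
      (trans (sym (size-map-odd rs)) (trans size≡ (cong (suc m +_) (+-identityʳ (suc m)))))

  count : HasCount n p132 p123 (2 ^ m)
  count = map permutation (compositions m)
        , Unique-map⁺ (λ rs∈ qs∈ → permutation-injective (compositions-size m rs∈) (compositions-size m qs∈))
                      (compositions-unique m)
        , trans (length-map permutation (compositions m)) (length-compositions m)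
        , λ π → mk⇔ (listed⇒avoiding π) (avoiding⇒listed π)
    where
    listed⇒avoiding : ∀ π → π ∈ map permutation (compositions m) → IsPAPAvoiding p132 p123 π
    listed⇒avoiding π π∈ with ∈-map⁻ permutation π∈
    ... | rs , rs∈ , refl = permutation-isPAPAvoiding rs (compositions-size m rs∈)
    avoiding⇒listed : ∀ π → IsPAPAvoiding p132 p123 π → π ∈ map permutation (compositions m)
    avoiding⇒listed π avoiding = listed (isPAPAvoiding⇒permutation π avoiding)
      where
      listed : ∃[ rs ] size rs ≡ suc m × π ≡ permutation rs → π ∈ map permutation (compositions m)
      listed (rs , composition , π≡) =
        subst (_∈ _) (sym π≡) (∈-map⁺ permutation (compositions-complete m rs composition))

mainTheorem10 : ((k : ℕ) → IsPAPAvoiding p132 p123 (decreasing (suc (2 * k))))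
                × ((k : ℕ) → (π : Vec (Fin (suc (2 * k))) (suc (2 * k)))
                  → IsPAPAvoiding p132 p123 π → π ≡ decreasing (suc (2 * k)))
                × ((m : ℕ) → HasCount (2 * suc m) p132 p123 (2 ^ m))
mainTheorem10 = (λ k → decreasing-isPAPAvoiding (suc[2*k]-odd k))
              , (λ k → isPAPAvoiding⇒decreasing (suc[2*k]-odd k))
              , EvenLength.count
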